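{- Let $C_n$ be the cycle on $n\geq 3$ vertices. Then $\lambda(M(C_n))=6$ if $n=3$, $8$ if $n=4$, $10$ if $n=5$, and $n+1$ if $n\geq 6$.
   Context: An $L(2,1)$-labeling of $G$ is a map $f:V\to\{0,1,2,\dots\}$ with $|f(x)-f(y)|\ge 2$ if $d_G(x,y)=1$ and $|f(x)-f(y)|\ge1$ if $d_G(x,y)=2$; $\lambda(G)$ is the minimum over such $f$ of the largest label. For $V=\{v_1,\dots,v_n\}$, the Mycielski graph $M(G)$ has vertex set $V\cup\{v_1',\dots,v_n'\}\cup\{u\}$ and edge set $E\cup\{v_iv_j' : v_iv_j\in E\}\cup\{v_i'u: 1\le i\le n\}$. -}

module Defs where

open import Data.Nat using (ℕ; zero; suc; _≤_; ∣_-_∣)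
open import Data.Fin using (Fin; toℕ)
open import Data.Product using (_×_; ∃)
open import Data.Sum using (_⊎_)
open import Data.Unit using (⊤)
open import Data.Empty using (⊥)
open import Relation.Nullary using (¬_)
open import Relation.Binary.PropositionalEquality using (_≡_; _≢_)

Graph : Set → Set₁
Graph V = V → V → Set

Dist2 : {V : Set} → Graph V → V → V → Set
Dist2 {V} G x y = x ≢ y × ¬ G x y × ∃ λ (z : V) → G x z × G z y

IsL21 : {V : Set} → Graph V → (V → ℕ) → Set
IsL21 G f =
  (∀ x y → G x y → 2 ≤ ∣ f x - f y ∣) ×
  (∀ x y → Dist2 G x y → 1 ≤ ∣ f x - f y ∣)

HasL21Within : {V : Set} → Graph V → ℕ → Set
HasL21Within {V} G k = ∃ λ (f : V → ℕ) → IsL21 G f × (∀ x → f x ≤ k)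

IsLambda : {V : Set} → Graph V → ℕ → Set
IsLambda G k = HasL21Within G k × (∀ j → HasL21Within G j → k ≤ j)

CycleAdj : (n : ℕ) → Fin n → Fin n → Set
CycleAdj n i j =
  suc (toℕ i) ≡ toℕ j ⊎ suc (toℕ j) ≡ toℕ i ⊎
  (toℕ i ≡ 0 × suc (toℕ j) ≡ n) ⊎ (toℕ j ≡ 0 × suc (toℕ i) ≡ n)

Cycle : (n : ℕ) → Graph (Fin n)
Cycle n = CycleAdj n

data MycV (V : Set) : Set where
  orig : V → MycV V
  copy : V → MycV V
  apex : MycV V

Mycielski : {V : Set} → Graph V → Graph (MycV V)
Mycielski G (orig a) (orig b) = G a b
Mycielski G (orig a) (copy b) = G a b
Mycielski G (copy a) (orig b) = G a b
Mycielski G (copy a) apex     = ⊤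
Mycielski G apex     (copy b) = ⊤
Mycielski G _        _        = ⊥

{-# OPTIONS --safe #-}

-- The copies v₀′, …, vₙ₋₁′ are pairwise at distance 2 through the apex u and all
-- adjacent to u, so their labels and f(u) are distinct, and one of f(u) ± 1 lies in [0, λ] but
-- is used by none of them: n + 2 labels, λ ≥ n + 1. For n ≤ 5, M(Cₙ) has diameter 2, so all
-- 2n + 1 labels are distinct and λ ≥ 2n.
--
-- Every L(2,1) constraint of M(Cₙ) lives in a window of three consecutive cycle
-- positions i, i + 1, i + 2 (originals and copies) together with u, so a labelling is checked
-- window by window. For n ≤ 11 explicit labellings are checked by computation. For n = 12 + m
-- put 0 on u and 2, …, n + 1 in order on the copies; the first six originals get n - 1, n - 3,
-- n + 1 twice, the others cycle through 1, 3, 5 so as to end on 5, next to v₀′ labelled 2.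
-- Each window then compares labels near n among themselves or with labels at most 9, or three
-- of 1, 3, 5 with copies labelled at least 8; interval bounds uniform in m decide all of these.

module Submission where

open import Defs
open import Data.Bool using (Bool; false; T; _∨_)
open import Data.Bool.Properties using (T-∨)
open import Data.Empty using (⊥)
open import Data.Fin using (Fin; zero; suc; toℕ; fromℕ<; punchOut; splitAt)
open import Data.Fin.Properties
  using (toℕ-injective; toℕ<n; toℕ-fromℕ<; punchOut-injective; injective⇒≤; any?; all?)
  renaming (_≟_ to _≟ᶠ_)
open import Data.List using (List; []; _∷_)
open import Data.Nat
open import Data.Nat.Properties
open import Data.Product using (∃; ∃₂; _×_; _,_; proj₁; proj₂)
open import Data.Sum using (_⊎_; inj₁; inj₂; [_,_]′)
open import Data.Unit using (⊤; tt)
open import Function using (_∘_; _|>_)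
open import Function.Bundles using (Equivalence)
open import Function.Definitions using (Injective)
open import Relation.Binary using (DecidableEquality)
open import Relation.Binary.PropositionalEquality
open import Relation.Nullary using (Dec; yes; no; ¬_; ¬?; contradiction)
open import Relation.Nullary.Decidable
  using (True; toWitness; map′; _×-dec_; _⊎-dec_; _→-dec_)

record Gap (d x y : ℕ) : Set where
  constructor gap
  field ≤∣-∣ : d ≤ ∣ x - y ∣

Gap? : ∀ d x y → Dec (Gap d x y)
Gap? d x y = map′ gap Gap.≤∣-∣ (d ≤? ∣ x - y ∣)

Gap-sym : ∀ {d x y} → Gap d x y → Gap d y x
Gap-sym {d} {x} {y} (gap d≤) = gap (subst (d ≤_) (∣-∣-comm x y) d≤)

Gap⇒≢ : ∀ {d x y} → Gap (suc d) x y → x ≢ y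
Gap⇒≢ {d} {x} (gap d<) refl = contradiction (subst (suc d ≤_) (∣n-n∣≡0 x) d<) λ ()

≢⇒Gap : ∀ {x y} → x ≢ y → Gap 1 x y
≢⇒Gap x≢y = gap (n≢0⇒n>0 (x≢y ∘ ∣m-n∣≡0⇒m≡n))

Gap-above : ∀ {d x y} → d + y ≤ x → Gap d x y
Gap-above {d} {x} {y} le = gap (≤-trans (m+n≤o⇒m≤o∸n d le) (m∸n≤∣m-n∣ x y))

-- The L(2,1) constraints that an original vertex v and its copy v′ of M(Cₙ) impose forwards
-- along the cycle: x₀ x₁ x₂ label three consecutive originals, y₀ y₁ y₂ their copies and
-- a the apex. Every constraint of M(Cₙ) is one of these for some window, possibly reversed.
record Window {A : Set} (Apart : ℕ → A → A → Set) (a x₀ x₁ x₂ y₀ y₁ y₂ : A) : Set where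
  constructor window
  field
    orig-orig   : Apart 2 x₀ x₁
    orig-copy   : Apart 2 x₀ y₁
    copy-orig   : Apart 2 y₀ x₁
    copy-apex   : Apart 2 y₀ a
    orig-apex   : Apart 1 x₀ a
    orig-orig₂  : Apart 1 x₀ x₂
    orig-copy₀  : Apart 1 x₀ y₀
    orig-copy₂  : Apart 1 x₀ y₂
    copy-orig₂  : Apart 1 y₀ x₂

window? : ∀ {A : Set} {Apart : ℕ → A → A → Set} → (∀ d x y → Dec (Apart d x y)) →
          ∀ a x₀ x₁ x₂ y₀ y₁ y₂ → Dec (Window Apart a x₀ x₁ x₂ y₀ y₁ y₂)
window? apart? a x₀ x₁ x₂ y₀ y₁ y₂ =
  map′ (λ (p₁ , p₂ , p₃ , p₄ , p₅ , p₆ , p₇ , p₈ , p₉) → window p₁ p₂ p₃ p₄ p₅ p₆ p₇ p₈ p₉)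
       (λ (window p₁ p₂ p₃ p₄ p₅ p₆ p₇ p₈ p₉) → p₁ , p₂ , p₃ , p₄ , p₅ , p₆ , p₇ , p₈ , p₉)
       (apart? 2 x₀ x₁ ×-dec apart? 2 x₀ y₁ ×-dec apart? 2 y₀ x₁ ×-dec apart? 2 y₀ a ×-dec
        apart? 1 x₀ a ×-dec apart? 1 x₀ x₂ ×-dec apart? 1 x₀ y₀ ×-dec apart? 1 x₀ y₂ ×-dec
        apart? 1 y₀ x₂)

Window-map : ∀ {A B : Set} {Apart : ℕ → A → A → Set} {Apart′ : ℕ → B → B → Set}
               (R : A → B → Set) → (∀ {d s t x y} → R s x → R t y → Apart d s t → Apart′ d x y) →
             ∀ {a x₀ x₁ x₂ y₀ y₁ y₂ a′ x₀′ x₁′ x₂′ y₀′ y₁′ y₂′} →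
             R a a′ → R x₀ x₀′ → R x₁ x₁′ → R x₂ x₂′ → R y₀ y₀′ → R y₁ y₁′ → R y₂ y₂′ →
             Window Apart a x₀ x₁ x₂ y₀ y₁ y₂ → Window Apart′ a′ x₀′ x₁′ x₂′ y₀′ y₁′ y₂′
Window-map R f ra r₀ r₁ r₂ s₀ s₁ s₂ (window p₁ p₂ p₃ p₄ p₅ p₆ p₇ p₈ p₉) =
  window (f r₀ r₁ p₁) (f r₀ s₁ p₂) (f s₀ r₁ p₃) (f s₀ ra p₄) (f r₀ ra p₅) (f r₀ r₂ p₆)
         (f r₀ s₀ p₇) (f r₀ s₂ p₈) (f s₀ r₂ p₉)

Step : ℕ → ℕ → ℕ → Set
Step n i j = suc i ≡ j ⊎ (j ≡ 0 × suc i ≡ n)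

CycleAdj⇒Step : ∀ {n} {i j : Fin n} → CycleAdj n i j →
                Step n (toℕ i) (toℕ j) ⊎ Step n (toℕ j) (toℕ i)
CycleAdj⇒Step (inj₁ i→j)               = inj₁ (inj₁ i→j)
CycleAdj⇒Step (inj₂ (inj₁ j→i))        = inj₂ (inj₁ j→i)
CycleAdj⇒Step (inj₂ (inj₂ (inj₁ j→i))) = inj₂ (inj₂ j→i)
CycleAdj⇒Step (inj₂ (inj₂ (inj₂ i→j))) = inj₁ (inj₂ i→j)

Step-injective : ∀ {n i j l} → Step n i l → Step n j l → i ≡ j
Step-injective (inj₁ refl)         (inj₁ refl)         = refl
Step-injective (inj₂ (refl , refl)) (inj₂ (_ , refl))  = refl
Step-injective (inj₁ refl)         (inj₂ (() , _))
Step-injective (inj₂ (refl , _))   (inj₁ ())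

Step-functional : ∀ {n i j l} → i < n → j < n → Step n l i → Step n l j → i ≡ j
Step-functional _   _   (inj₁ refl)       (inj₁ refl)        = refl
Step-functional _   _   (inj₂ (refl , _)) (inj₂ (refl , _))  = refl
Step-functional i<n _   (inj₁ refl)       (inj₂ (_ , refl))  = contradiction i<n (<-irrefl refl)
Step-functional _   j<n (inj₂ (_ , refl)) (inj₁ refl)        = contradiction j<n (<-irrefl refl)

Step-total : ∀ {n i} → i < n → ∃ λ j → j < n × Step n i j
Step-total {n} {i} i<n with m≤n⇒m<n∨m≡n i<n
... | inj₁ i+1<n = suc i , i+1<n , inj₁ refl
... | inj₂ i+1≡n = 0 , ≤-trans (s≤s z≤n) i<n , inj₂ (refl , i+1≡n)

mycLabel : ∀ {V : Set} → (V → ℕ) → (V → ℕ) → ℕ → MycV V → ℕ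
mycLabel o c a (orig v) = o v
mycLabel o c a (copy v) = c v
mycLabel o c a apex     = a

-- A labelling of M(C₍₃₊ₖ₎) by o, c on originals and copies (indexed by ℕ) and a on the apex,
-- described by its 3 + k windows: k + 1 along the path 0 → ⋯ → k + 2 and two wrapping around.
record IsWindowed (k : ℕ) (o c : ℕ → ℕ) (a : ℕ) : Set where
  field
    along           : ∀ {i} → i < suc k →
                      Window Gap a (o i) (o (1 + i)) (o (2 + i)) (c i) (c (1 + i)) (c (2 + i))
    wrap₁           : Window Gap a (o (1 + k)) (o (2 + k)) (o 0) (c (1 + k)) (c (2 + k)) (c 0)
    wrap₀           : Window Gap a (o (2 + k)) (o 0) (o 1) (c (2 + k)) (c 0) (c 1)
    copies-distinct : ∀ {i j} → i < 3 + k → j < 3 + k → i ≢ j → c i ≢ c j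

module _ {k : ℕ} {o c : ℕ → ℕ} {a : ℕ} (windowed : IsWindowed k o c a) where
  open IsWindowed windowed
  open Window

  private
    n : ℕ
    n = 3 + k

    W : ℕ → ℕ → ℕ → Set
    W i j l = Window Gap a (o i) (o j) (o l) (c i) (c j) (c l)

    f : MycV (Fin n) → ℕ
    f = mycLabel (o ∘ toℕ) (c ∘ toℕ) a

  windowAt : ∀ {i j l} → Step n i j → Step n j l → l < n → W i j l
  windowAt (inj₁ refl)         (inj₁ refl)         l<n = along (s≤s⁻¹ (s≤s⁻¹ l<n))
  windowAt (inj₁ refl)         (inj₂ (refl , refl)) _   = wrap₁
  windowAt (inj₂ (refl , refl)) (inj₁ refl)         _   = wrap₀
  windowAt (inj₂ (refl , refl)) (inj₂ (refl , ()))  _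

  edgeWindow : ∀ {i j} → Step n i j → j < n → ∃ (W i j)
  edgeWindow i→j j<n with l , l<n , j→l ← Step-total j<n = l , windowAt i→j j→l l<n

  vertexWindow : ∀ {i} → i < n → ∃₂ (W i)
  vertexWindow i<n with j , j<n , i→j ← Step-total i<n = j , edgeWindow i→j j<n

  pathWindow : ∀ {i w j : Fin n} → CycleAdj n i w → CycleAdj n w j → i ≢ j →
               W (toℕ i) (toℕ w) (toℕ j) ⊎ W (toℕ j) (toℕ w) (toℕ i)
  pathWindow {i} {w} {j} i~w w~j i≢j with CycleAdj⇒Step i~w | CycleAdj⇒Step w~j
  ... | inj₁ i→w | inj₁ w→j = inj₁ (windowAt i→w w→j (toℕ<n j))
  ... | inj₂ w→i | inj₂ j→w = inj₂ (windowAt j→w w→i (toℕ<n i))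
  ... | inj₁ i→w | inj₂ j→w = contradiction (toℕ-injective (Step-injective i→w j→w)) i≢j
  ... | inj₂ w→i | inj₁ w→j =
    contradiction (toℕ-injective (Step-functional (toℕ<n i) (toℕ<n j) w→i w→j)) i≢j

  adjacent⇒Gap : ∀ x y → Mycielski (Cycle n) x y → Gap 2 (f x) (f y)
  adjacent⇒Gap (orig i) (orig j) i~j with CycleAdj⇒Step i~j
  ... | inj₁ i→j with _ , w ← edgeWindow i→j (toℕ<n j) = orig-orig w
  ... | inj₂ j→i with _ , w ← edgeWindow j→i (toℕ<n i) = Gap-sym (orig-orig w)
  adjacent⇒Gap (orig i) (copy j) i~j with CycleAdj⇒Step i~j
  ... | inj₁ i→j with _ , w ← edgeWindow i→j (toℕ<n j) = orig-copy w
  ... | inj₂ j→i with _ , w ← edgeWindow j→i (toℕ<n i) = Gap-sym (copy-orig w)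
  adjacent⇒Gap (copy i) (orig j) i~j with CycleAdj⇒Step i~j
  ... | inj₁ i→j with _ , w ← edgeWindow i→j (toℕ<n j) = copy-orig w
  ... | inj₂ j→i with _ , w ← edgeWindow j→i (toℕ<n i) = Gap-sym (orig-copy w)
  adjacent⇒Gap (copy i) apex _ with _ , _ , w ← vertexWindow (toℕ<n i) = copy-apex w
  adjacent⇒Gap apex (copy j) _ with _ , _ , w ← vertexWindow (toℕ<n j) = Gap-sym (copy-apex w)

  origs-Gap : ∀ i w j → orig i ≢ orig j → CycleAdj n i w → CycleAdj n w j →
              Gap 1 (o (toℕ i)) (o (toℕ j))
  origs-Gap i w j x≢y i~w w~j with pathWindow i~w w~j (x≢y ∘ cong orig)
  ... | inj₁ v = orig-orig₂ v
  ... | inj₂ v = Gap-sym (orig-orig₂ v)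

  copies-Gap : ∀ i j → copy i ≢ copy j → Gap 1 (c (toℕ i)) (c (toℕ j))
  copies-Gap i j x≢y =
    ≢⇒Gap (copies-distinct (toℕ<n i) (toℕ<n j) (x≢y ∘ cong copy ∘ toℕ-injective))

  distance₂⇒Gap : ∀ x z y → x ≢ y → Mycielski (Cycle n) x z → Mycielski (Cycle n) z y →
                  Gap 1 (f x) (f y)
  distance₂⇒Gap (orig i) (orig w) (orig j) x≢y i~w w~j = origs-Gap i w j x≢y i~w w~j
  distance₂⇒Gap (orig i) (copy w) (orig j) x≢y i~w w~j = origs-Gap i w j x≢y i~w w~j
  distance₂⇒Gap (orig i) (orig w) (copy j) _ i~w w~j with i ≟ᶠ j
  ... | yes refl with _ , _ , v ← vertexWindow (toℕ<n i) = orig-copy₀ v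
  ... | no i≢j with pathWindow i~w w~j i≢j
  ...   | inj₁ v = orig-copy₂ v
  ...   | inj₂ v = Gap-sym (copy-orig₂ v)
  distance₂⇒Gap (copy i) (orig w) (orig j) _ i~w w~j with i ≟ᶠ j
  ... | yes refl with _ , _ , v ← vertexWindow (toℕ<n i) = Gap-sym (orig-copy₀ v)
  ... | no i≢j with pathWindow i~w w~j i≢j
  ...   | inj₁ v = copy-orig₂ v
  ...   | inj₂ v = Gap-sym (orig-copy₂ v)
  distance₂⇒Gap (copy i) (orig _) (copy j) x≢y _ _ = copies-Gap i j x≢y
  distance₂⇒Gap (copy i) apex     (copy j) x≢y _ _ = copies-Gap i j x≢y
  distance₂⇒Gap (orig i) (copy _) apex _ _ _ with _ , _ , v ← vertexWindow (toℕ<n i) = orig-apex v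
  distance₂⇒Gap apex (copy _) (orig j) _ _ _ with _ , _ , v ← vertexWindow (toℕ<n j) =
    Gap-sym (orig-apex v)
  distance₂⇒Gap apex (copy _) apex x≢y _ _ = contradiction refl x≢y
  distance₂⇒Gap (orig _) (orig _) apex     _ _ ()
  distance₂⇒Gap (orig _) (copy _) (copy _) _ _ ()
  distance₂⇒Gap (orig _) apex     _        _ () _
  distance₂⇒Gap (copy _) (copy _) _        _ () _
  distance₂⇒Gap (copy _) (orig _) apex     _ _ ()
  distance₂⇒Gap (copy _) apex     (orig _) _ _ ()
  distance₂⇒Gap (copy _) apex     apex     _ _ ()
  distance₂⇒Gap apex     (orig _) _        _ () _
  distance₂⇒Gap apex     apex     _        _ () _
  distance₂⇒Gap apex     (copy _) (copy _) _ _ ()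

  windowed⇒IsL21 : IsL21 (Mycielski (Cycle n)) f
  windowed⇒IsL21 =
    (λ x y x~y → Gap.≤∣-∣ (adjacent⇒Gap x y x~y)) ,
    (λ x y (x≢y , _ , z , x~z , z~y) → Gap.≤∣-∣ (distance₂⇒Gap x z y x≢y x~z z~y))

LabelsWithin : ℕ → (ℕ → ℕ) → (ℕ → ℕ) → ℕ → ℕ → Set
LabelsWithin n o c a K = (∀ {i} → i < n → o i ≤ K) × (∀ {i} → i < n → c i ≤ K) × a ≤ K

windowed⇒HasL21Within : ∀ {k o c a K} → IsWindowed k o c a → LabelsWithin (3 + k) o c a K →
                         HasL21Within (Mycielski (Cycle (3 + k))) K
windowed⇒HasL21Within {o = o} {c} {a} windowed (o≤K , c≤K , a≤K) =
  mycLabel (o ∘ toℕ) (c ∘ toℕ) a , windowed⇒IsL21 windowed , labels≤K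
  where
  labels≤K : ∀ x → mycLabel (o ∘ toℕ) (c ∘ toℕ) a x ≤ _
  labels≤K (orig i) = o≤K (toℕ<n i)
  labels≤K (copy i) = c≤K (toℕ<n i)
  labels≤K apex     = a≤K

IsWindowed? : ∀ k o c a → Dec (IsWindowed k o c a)
IsWindowed? k o c a =
  let along? = allUpTo? (λ i → window? Gap? a (o i) (o (1 + i)) (o (2 + i))
                                                (c i) (c (1 + i)) (c (2 + i))) (suc k)
      wrap₁? = window? Gap? a (o (1 + k)) (o (2 + k)) (o 0) (c (1 + k)) (c (2 + k)) (c 0)
      wrap₀? = window? Gap? a (o (2 + k)) (o 0) (o 1) (c (2 + k)) (c 0) (c 1)
      distinct? = allUpTo? (λ i → allUpTo? (λ j → ¬? (i ≟ j) →-dec ¬? (c i ≟ c j)) (3 + k)) (3 + k)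
  in along? ×-dec wrap₁? ×-dec wrap₀? ×-dec distinct? |> map′
       (λ (p , q , r , s) → record { along = p ; wrap₁ = q ; wrap₀ = r
                                   ; copies-distinct = λ i< j< → s i< j< })
       (λ w → let open IsWindowed w in along , wrap₁ , wrap₀ , λ i< j< → copies-distinct i< j<)

LabelsWithin? : ∀ n o c a K → Dec (LabelsWithin n o c a K)
LabelsWithin? n o c a K =
  allUpTo? (λ i → o i ≤? K) n ×-dec allUpTo? (λ i → c i ≤? K) n ×-dec a ≤? K

checkedLabelling : ∀ k o c a K → {True (IsWindowed? k o c a ×-dec LabelsWithin? (3 + k) o c a K)} →
                   HasL21Within (Mycielski (Cycle (3 + k))) K
checkedLabelling k o c a K {ok} = let (w , b) = toWitness ok in windowed⇒HasL21Within w b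

injective-avoiding⇒≤ : ∀ {m k h} (ℓ : Fin m → ℕ) → Injective _≡_ _≡_ ℓ →
                       (∀ i → ℓ i ≤ k) → h ≤ k → (∀ i → ℓ i ≢ h) → m ≤ k
injective-avoiding⇒≤ {k = k} {h} ℓ ℓ-injective ℓ≤k h≤k ℓ≢h = injective⇒≤ squeeze-injective
  where
  toFin : ∀ {x} → x ≤ k → Fin (suc k)
  toFin x≤k = fromℕ< (s≤s x≤k)

  hole≢ : ∀ i → toFin h≤k ≢ toFin (ℓ≤k i)
  hole≢ i e = ℓ≢h i (trans (sym (toℕ-fromℕ< _)) (trans (cong toℕ (sym e)) (toℕ-fromℕ< _)))

  squeeze-injective : Injective _≡_ _≡_ (λ i → punchOut (hole≢ i))
  squeeze-injective {i} {j} e = ℓ-injective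
    (trans (sym (toℕ-fromℕ< _)) (trans (cong toℕ (punchOut-injective (hole≢ i) (hole≢ j) e))
                                       (toℕ-fromℕ< _)))

Close : ∀ {V : Set} → Graph V → V → V → Set
Close G x y = G x y ⊎ Dist2 G x y

pairwise-close⇒≤ : ∀ {V : Set} {G : Graph V} {m k} (enum : Fin m → V) →
                   (∀ i j → i ≢ j → Close G (enum i) (enum j)) →
                   HasL21Within G k → m ≤ suc k
pairwise-close⇒≤ {k = k} enum close (f , (adjacent , distance₂) , f≤k) =
  injective-avoiding⇒≤ (f ∘ enum) distinct (λ i → m≤n⇒m≤1+n (f≤k (enum i))) ≤-refl
                       (λ i eq → 1+n≰n (subst (_≤ k) eq (f≤k (enum i))))
  where
  distinct : Injective _≡_ _≡_ (f ∘ enum)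
  distinct {i} {j} eq with i ≟ᶠ j
  ... | yes i≡j = i≡j
  ... | no i≢j with close i j i≢j
  ...   | inj₁ adj   = contradiction eq (Gap⇒≢ (gap (adjacent _ _ adj)))
  ...   | inj₂ dist₂ = contradiction eq (Gap⇒≢ (gap (distance₂ _ _ dist₂)))

∣n-1+n∣≡1 : ∀ n → ∣ n - suc n ∣ ≡ 1
∣n-1+n∣≡1 zero    = refl
∣n-1+n∣≡1 (suc n) = ∣n-1+n∣≡1 n

gap≤bound : ∀ {d x y k} → d ≤ ∣ x - y ∣ → x ≤ k → y ≤ k → d ≤ k
gap≤bound {x = x} {y} d≤ x≤k y≤k = ≤-trans d≤ (≤-trans (∣m-n∣≤m⊔n x y) (⊔-lub x≤k y≤k))

neighbour : ∀ {a k} → a ≤ k → 0 < k → ∃ λ h → h ≤ k × ∣ h - a ∣ ≡ 1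
neighbour {zero}  _   0<k = 1 , 0<k , refl
neighbour {suc a} a<k _   = a , ≤-trans (n≤1+n a) a<k , ∣n-1+n∣≡1 a

copies-apex-bound : ∀ {n k} {G : Graph (Fin n)} → 0 < n → HasL21Within (Mycielski G) k → suc n ≤ k
copies-apex-bound {suc n} {k} _ (f , (adjacent , distance₂) , f≤k)
  with h , h≤k , ∣h-apex∣≡1 ←
         neighbour (f≤k apex)
                   (≤-trans (s≤s z≤n) (gap≤bound (adjacent (copy zero) apex tt) (f≤k _) (f≤k _)))
  = injective-avoiding⇒≤ (f ∘ vertex) distinct (f≤k ∘ vertex) h≤k (avoids ∣h-apex∣≡1)
  where
  vertex : Fin (suc (suc n)) → MycV (Fin (suc n))
  vertex zero    = apex
  vertex (suc i) = copy i

  copy-apex : ∀ i → 2 ≤ ∣ f (copy i) - f apex ∣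
  copy-apex i = adjacent (copy i) apex tt

  avoids : ∀ {h} → ∣ h - f apex ∣ ≡ 1 → ∀ i → f (vertex i) ≢ h
  avoids {h} ∣h-apex∣≡1 zero    eq =
    contradiction (trans (sym (∣n-n∣≡0 h)) (subst (λ x → ∣ h - x ∣ ≡ 1) eq ∣h-apex∣≡1)) λ ()
  avoids     ∣h-apex∣≡1 (suc i) eq =
    contradiction (subst (λ x → 2 ≤ ∣ x - f apex ∣) eq (copy-apex i))
                  (subst (λ d → ¬ 2 ≤ d) (sym ∣h-apex∣≡1) λ { (s≤s ()) })

  distinct : Injective _≡_ _≡_ (f ∘ vertex)
  distinct {zero}  {zero}  _  = refl
  distinct {zero}  {suc j} eq = contradiction (sym eq) (Gap⇒≢ (gap (copy-apex j)))
  distinct {suc i} {zero}  eq = contradiction eq (Gap⇒≢ (gap (copy-apex i)))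
  distinct {suc i} {suc j} eq with i ≟ᶠ j
  ... | yes refl = refl
  ... | no i≢j = contradiction eq
    (Gap⇒≢ (gap (distance₂ (copy i) (copy j) ((λ { refl → i≢j refl }) , (λ ()) , apex , tt , tt))))

Searchable : Set → Set₁
Searchable V = ∀ {P : V → Set} → (∀ x → Dec (P x)) → Dec (∃ P)

MycV-searchable : ∀ {V : Set} → Searchable V → Searchable (MycV V)
MycV-searchable search P? with search (P? ∘ orig) | search (P? ∘ copy) | P? apex
... | yes (v , p) | _           | _     = yes (orig v , p)
... | no _        | yes (v , p) | _     = yes (copy v , p)
... | no _        | no _        | yes p = yes (apex , p)
... | no ¬orig    | no ¬copy    | no ¬apex =
  no λ { (orig v , p) → ¬orig (v , p) ; (copy v , p) → ¬copy (v , p) ; (apex , p) → ¬apex p }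

MycV-≟ : ∀ {V : Set} → DecidableEquality V → DecidableEquality (MycV V)
MycV-≟ _≟ᵥ_ (orig u) (orig v) = map′ (cong orig) (λ { refl → refl }) (u ≟ᵥ v)
MycV-≟ _≟ᵥ_ (copy u) (copy v) = map′ (cong copy) (λ { refl → refl }) (u ≟ᵥ v)
MycV-≟ _    apex     apex     = yes refl
MycV-≟ _    (orig _) (copy _) = no λ ()
MycV-≟ _    (orig _) apex     = no λ ()
MycV-≟ _    (copy _) (orig _) = no λ ()
MycV-≟ _    (copy _) apex     = no λ ()
MycV-≟ _    apex     (orig _) = no λ ()
MycV-≟ _    apex     (copy _) = no λ ()

Mycielski? : ∀ {V : Set} {G : Graph V} → (∀ u v → Dec (G u v)) → ∀ x y → Dec (Mycielski G x y)
Mycielski? G? (orig u) (orig v) = G? u v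
Mycielski? G? (orig u) (copy v) = G? u v
Mycielski? G? (copy u) (orig v) = G? u v
Mycielski? _  (copy _) apex     = yes tt
Mycielski? _  apex     (copy _) = yes tt
Mycielski? _  (orig _) apex     = no λ ()
Mycielski? _  (copy _) (copy _) = no λ ()
Mycielski? _  apex     (orig _) = no λ ()
Mycielski? _  apex     apex     = no λ ()

Close? : ∀ {V : Set} {G : Graph V} → DecidableEquality V → Searchable V →
         (∀ x y → Dec (G x y)) → ∀ x y → Dec (Close G x y)
Close? _≟ᵥ_ search G? x y =
  G? x y ⊎-dec (¬? (x ≟ᵥ y) ×-dec ¬? (G? x y) ×-dec search (λ z → G? x z ×-dec G? z y))

CycleAdj? : ∀ n (i j : Fin n) → Dec (CycleAdj n i j)
CycleAdj? n i j =
  suc (toℕ i) ≟ toℕ j ⊎-dec suc (toℕ j) ≟ toℕ i ⊎-dec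
  (toℕ i ≟ 0 ×-dec suc (toℕ j) ≟ n) ⊎-dec (toℕ j ≟ 0 ×-dec suc (toℕ i) ≟ n)

vertices : ∀ n → Fin (suc (n + n)) → MycV (Fin n)
vertices n zero    = apex
vertices n (suc i) = [ orig , copy ]′ (splitAt n i)

-- Holds for n ≤ 5 only: for n ≥ 6 the originals v₀ and v₃ are at distance 3.
Diameter₂? : ∀ n → Dec (∀ i j → i ≢ j → Close (Mycielski (Cycle n)) (vertices n i) (vertices n j))
Diameter₂? n = all? λ i → all? λ j → ¬? (i ≟ᶠ j) →-dec
  Close? (MycV-≟ _≟ᶠ_) (MycV-searchable any?) (Mycielski? (CycleAdj? n))
         (vertices n i) (vertices n j)

diameter₂⇒2n≤ : ∀ n {k} → {True (Diameter₂? n)} → HasL21Within (Mycielski (Cycle n)) k → n + n ≤ k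
diameter₂⇒2n≤ n {_} {diameter₂} labelling =
  s≤s⁻¹ (pairwise-close⇒≤ (vertices n) (toWitness diameter₂) labelling)

data Bound : Set where
  lit shifted : ℕ → Bound
  ∞           : Bound

-- A shape is an interval of labels described uniformly in a parameter m: lit p stands for p
-- and shifted p for p + m. Windows of shapes are checked by evaluation once for all m.
Shape : Set
Shape = Bound × Bound

LowerBound UpperBound : ℕ → Bound → ℕ → Set
LowerBound m (lit p)     x = p ≤ x
LowerBound m (shifted p) x = p + m ≤ x
LowerBound m ∞           x = ⊥
UpperBound m (lit p)     x = x ≤ p
UpperBound m (shifted p) x = x ≤ p + m
UpperBound m ∞           x = ⊤

record _∈_at_ (x : ℕ) (s : Shape) (m : ℕ) : Set where
  constructor bounds
  field
    lower : LowerBound m (proj₁ s) x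
    upper : UpperBound m (proj₂ s) x

exactly shifted-by : ℕ → Shape
exactly p    = lit p , lit p
shifted-by p = shifted p , shifted p

within : ℕ → ℕ → Shape
within p q = lit p , lit q

atLeast : ℕ → Shape
atLeast p = lit p , ∞

exactly∈ : ∀ {m x p} → x ≡ p → x ∈ exactly p at m
exactly∈ refl = bounds ≤-refl ≤-refl

shifted∈ : ∀ {m x p} → x ≡ p + m → x ∈ shifted-by p at m
shifted∈ refl = bounds ≤-refl ≤-refl

-- clears d hi lo: every value below hi lies at least d below every value above lo, for all m.
clears : ℕ → Bound → Bound → Bool
clears d (lit q)     (lit p)     = d + q ≤ᵇ p
clears d (lit q)     (shifted p) = d + q ≤ᵇ p
clears d (shifted q) (shifted p) = d + q ≤ᵇ p
clears _ _           _           = false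

clears-sound : ∀ {d hi lo m x y} → T (clears d hi lo) → UpperBound m hi y → LowerBound m lo x →
               d + y ≤ x
clears-sound {d} {lit q} {lit p} ok y≤q p≤x =
  ≤-trans (+-monoʳ-≤ d y≤q) (≤-trans (≤ᵇ⇒≤ _ _ ok) p≤x)
clears-sound {d} {lit q} {shifted p} {m} ok y≤q p+m≤x =
  ≤-trans (+-monoʳ-≤ d y≤q) (≤-trans (≤ᵇ⇒≤ _ _ ok) (≤-trans (m≤m+n p m) p+m≤x))
clears-sound {d} {shifted q} {shifted p} {m} ok y≤q+m p+m≤x = begin
  d + _       ≤⟨ +-monoʳ-≤ d y≤q+m ⟩
  d + (q + m) ≡⟨ +-assoc d q m ⟨
  d + q + m   ≤⟨ +-monoˡ-≤ m (≤ᵇ⇒≤ _ _ ok) ⟩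
  p + m       ≤⟨ p+m≤x ⟩
  _           ∎
  where open ≤-Reasoning

ShapesApart : ℕ → Shape → Shape → Set
ShapesApart d (lo , hi) (lo′ , hi′) = T (clears d hi′ lo ∨ clears d hi lo′)

ShapesApart-sound : ∀ {d s t m x y} → x ∈ s at m → y ∈ t at m → ShapesApart d s t → Gap d x y
ShapesApart-sound {d} {lo , hi} {lo′ , hi′} (bounds lo≤x x≤hi) (bounds lo′≤y y≤hi′) apart
  with Equivalence.to T-∨ apart
... | inj₁ t-below-s = Gap-above (clears-sound t-below-s y≤hi′ lo≤x)
... | inj₂ s-below-t = Gap-sym (Gap-above (clears-sound s-below-t x≤hi lo′≤y))

shaped-window : ∀ {m} (sa s₀ s₁ s₂ t₀ t₁ t₂ : Shape) → Window ShapesApart sa s₀ s₁ s₂ t₀ t₁ t₂ →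
                ∀ {a x₀ x₁ x₂ y₀ y₁ y₂} →
                a ∈ sa at m → x₀ ∈ s₀ at m → x₁ ∈ s₁ at m → x₂ ∈ s₂ at m →
                y₀ ∈ t₀ at m → y₁ ∈ t₁ at m → y₂ ∈ t₂ at m → Window Gap a x₀ x₁ x₂ y₀ y₁ y₂
shaped-window {m} _ _ _ _ _ _ _ shapes a∈ x₀∈ x₁∈ x₂∈ y₀∈ y₁∈ y₂∈ =
  Window-map (λ s x → x ∈ s at m) (λ x∈ y∈ → ShapesApart-sound x∈ y∈)
             a∈ x₀∈ x₁∈ x₂∈ y₀∈ y₁∈ y₂∈ shapes

lowLabel : ℕ → ℕ
lowLabel 0                   = 5
lowLabel 1                   = 3
lowLabel 2                   = 1
lowLabel (suc (suc (suc d))) = lowLabel d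

lowLabel∈ : ∀ {m} d → lowLabel d ∈ within 1 5 at m
lowLabel∈ 0                   = bounds (s≤s z≤n) ≤-refl
lowLabel∈ 1                   = bounds (s≤s z≤n) (≤ᵇ⇒≤ 3 5 _)
lowLabel∈ 2                   = bounds ≤-refl (s≤s z≤n)
lowLabel∈ (suc (suc (suc d))) = lowLabel∈ d

lowLabel-window : ∀ d {y₀ y₁ y₂} → 8 ≤ y₀ → 8 ≤ y₁ → 8 ≤ y₂ →
                  Window Gap 0 (lowLabel (2 + d)) (lowLabel (1 + d)) (lowLabel d) y₀ y₁ y₂
lowLabel-window 0 8≤y₀ 8≤y₁ 8≤y₂ =
  shaped-window {0} (exactly 0) (exactly 1) (exactly 3) (exactly 5)
                    (atLeast 8) (atLeast 8) (atLeast 8) _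
    (exactly∈ refl) (exactly∈ refl) (exactly∈ refl) (exactly∈ refl)
    (bounds 8≤y₀ tt) (bounds 8≤y₁ tt) (bounds 8≤y₂ tt)
lowLabel-window 1 8≤y₀ 8≤y₁ 8≤y₂ =
  shaped-window {0} (exactly 0) (exactly 5) (exactly 1) (exactly 3)
                    (atLeast 8) (atLeast 8) (atLeast 8) _
    (exactly∈ refl) (exactly∈ refl) (exactly∈ refl) (exactly∈ refl)
    (bounds 8≤y₀ tt) (bounds 8≤y₁ tt) (bounds 8≤y₂ tt)
lowLabel-window 2 8≤y₀ 8≤y₁ 8≤y₂ =
  shaped-window {0} (exactly 0) (exactly 3) (exactly 5) (exactly 1)
                    (atLeast 8) (atLeast 8) (atLeast 8) _
    (exactly∈ refl) (exactly∈ refl) (exactly∈ refl) (exactly∈ refl)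
    (bounds 8≤y₀ tt) (bounds 8≤y₁ tt) (bounds 8≤y₂ tt)
lowLabel-window (suc (suc (suc d))) = lowLabel-window d

module LargeCycle (m : ℕ) where

  origLabel : ℕ → ℕ
  origLabel 0 = 11 + m
  origLabel 1 = 9 + m
  origLabel 2 = 13 + m
  origLabel 3 = 11 + m
  origLabel 4 = 9 + m
  origLabel 5 = 13 + m
  origLabel (suc (suc (suc (suc (suc (suc j)))))) = lowLabel (5 + m ∸ j)

  copyLabel : ℕ → ℕ
  copyLabel i = 2 + i

  along : ∀ {i} → i < 10 + m →
          Window Gap 0 (origLabel i) (origLabel (1 + i)) (origLabel (2 + i))
                       (copyLabel i) (copyLabel (1 + i)) (copyLabel (2 + i))
  along {0} _ =
    shaped-window (exactly 0) (shifted-by 11) (shifted-by 9) (shifted-by 13)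
                  (exactly 2) (exactly 3) (exactly 4) _
      (exactly∈ refl) (shifted∈ refl) (shifted∈ refl) (shifted∈ refl)
      (exactly∈ refl) (exactly∈ refl) (exactly∈ refl)
  along {1} _ =
    shaped-window (exactly 0) (shifted-by 9) (shifted-by 13) (shifted-by 11)
                  (exactly 3) (exactly 4) (exactly 5) _
      (exactly∈ refl) (shifted∈ refl) (shifted∈ refl) (shifted∈ refl)
      (exactly∈ refl) (exactly∈ refl) (exactly∈ refl)
  along {2} _ =
    shaped-window (exactly 0) (shifted-by 13) (shifted-by 11) (shifted-by 9)
                  (exactly 4) (exactly 5) (exactly 6) _
      (exactly∈ refl) (shifted∈ refl) (shifted∈ refl) (shifted∈ refl)
      (exactly∈ refl) (exactly∈ refl) (exactly∈ refl)
  along {3} _ =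
    shaped-window (exactly 0) (shifted-by 11) (shifted-by 9) (shifted-by 13)
                  (exactly 5) (exactly 6) (exactly 7) _
      (exactly∈ refl) (shifted∈ refl) (shifted∈ refl) (shifted∈ refl)
      (exactly∈ refl) (exactly∈ refl) (exactly∈ refl)
  along {4} _ =
    shaped-window (exactly 0) (shifted-by 9) (shifted-by 13) (within 1 5)
                  (exactly 6) (exactly 7) (exactly 8) _
      (exactly∈ refl) (shifted∈ refl) (shifted∈ refl) (lowLabel∈ (5 + m))
      (exactly∈ refl) (exactly∈ refl) (exactly∈ refl)
  along {5} _ =
    shaped-window (exactly 0) (shifted-by 13) (within 1 5) (within 1 5)
                  (exactly 7) (exactly 8) (exactly 9) _
      (exactly∈ refl) (shifted∈ refl) (lowLabel∈ (5 + m)) (lowLabel∈ (4 + m))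
      (exactly∈ refl) (exactly∈ refl) (exactly∈ refl)
  along {suc (suc (suc (suc (suc (suc j)))))} 6+j<10+m =
    subst₂ (λ u v → Window Gap 0 (lowLabel u) (lowLabel v) (lowLabel (3 + m ∸ j))
                                 (8 + j) (9 + j) (10 + j))
           (sym (+-∸-assoc 2 j≤3+m)) (sym (+-∸-assoc 1 j≤3+m))
           (lowLabel-window (3 + m ∸ j) 8≤8+j (m≤n⇒m≤1+n 8≤8+j)
                            (m≤n⇒m≤1+n (m≤n⇒m≤1+n 8≤8+j)))
    where
    8≤8+j : 8 ≤ 8 + j
    8≤8+j = m≤m+n 8 j

    j≤3+m : j ≤ 3 + m
    j≤3+m = s≤s⁻¹ (s≤s⁻¹ (s≤s⁻¹ (s≤s⁻¹ (s≤s⁻¹ (s≤s⁻¹ (s≤s⁻¹ 6+j<10+m))))))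

  origLabel-penultimate : origLabel (10 + m) ≡ 3
  origLabel-penultimate = cong lowLabel (m+n∸n≡m 1 (4 + m))

  origLabel-last : origLabel (11 + m) ≡ 5
  origLabel-last = cong lowLabel (n∸n≡0 (5 + m))

  windowed : IsWindowed (9 + m) origLabel copyLabel 0
  windowed = record
    { along = along
    ; wrap₁ =
        shaped-window (exactly 0) (exactly 3) (exactly 5) (shifted-by 11)
                      (shifted-by 12) (shifted-by 13) (exactly 2) _
          (exactly∈ refl) (exactly∈ origLabel-penultimate) (exactly∈ origLabel-last) (shifted∈ refl)
          (shifted∈ refl) (shifted∈ refl) (exactly∈ refl)
    ; wrap₀ =
        shaped-window (exactly 0) (exactly 5) (shifted-by 11) (shifted-by 9)
                      (shifted-by 13) (exactly 2) (exactly 3) _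
          (exactly∈ refl) (exactly∈ origLabel-last) (shifted∈ refl) (shifted∈ refl)
          (shifted∈ refl) (exactly∈ refl) (exactly∈ refl)
    ; copies-distinct = λ _ _ i≢j → i≢j ∘ +-cancelˡ-≡ 2 _ _
    }

  bounded : LabelsWithin (12 + m) origLabel copyLabel 0 (13 + m)
  bounded = origLabel≤ , s≤s , z≤n
    where
    origLabel≤ : ∀ {i} → i < 12 + m → origLabel i ≤ 13 + m
    origLabel≤ {0} _ = +-monoˡ-≤ m (≤ᵇ⇒≤ 11 13 _)
    origLabel≤ {1} _ = +-monoˡ-≤ m (≤ᵇ⇒≤ 9 13 _)
    origLabel≤ {2} _ = ≤-refl
    origLabel≤ {3} _ = +-monoˡ-≤ m (≤ᵇ⇒≤ 11 13 _)
    origLabel≤ {4} _ = +-monoˡ-≤ m (≤ᵇ⇒≤ 9 13 _)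
    origLabel≤ {5} _ = ≤-refl
    origLabel≤ {suc (suc (suc (suc (suc (suc j)))))} _ =
      ≤-trans (_∈_at_.upper (lowLabel∈ {m} (5 + m ∸ j))) (≤-trans (≤ᵇ⇒≤ 5 13 _) (m≤m+n 13 m))

  labelling : HasL21Within (Mycielski (Cycle (12 + m))) (13 + m)
  labelling = windowed⇒HasL21Within windowed bounded

labels : List ℕ → ℕ → ℕ
labels []       _       = 0
labels (x ∷ _)  zero    = x
labels (_ ∷ xs) (suc i) = labels xs i

labelling₃ : HasL21Within (Mycielski (Cycle 3)) 6
labelling₃ = checkedLabelling 0 (labels (2 ∷ 0 ∷ 6 ∷ [])) (labels (3 ∷ 4 ∷ 5 ∷ [])) 1 6

labelling₄ : HasL21Within (Mycielski (Cycle 4)) 8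
labelling₄ = checkedLabelling 1 (labels (1 ∷ 4 ∷ 8 ∷ 5 ∷ [])) (labels (2 ∷ 3 ∷ 7 ∷ 6 ∷ [])) 0 8

labelling₅ : HasL21Within (Mycielski (Cycle 5)) 10
labelling₅ = checkedLabelling 2 (labels (1 ∷ 9 ∷ 7 ∷ 10 ∷ 8 ∷ [])) (2 +_) 0 10

labelling₆₊ : ∀ k → HasL21Within (Mycielski (Cycle (6 + k))) (6 + k + 1)
labelling₆₊ 0 =
  checkedLabelling 3 (labels (1 ∷ 4 ∷ 7 ∷ 1 ∷ 3 ∷ 6 ∷ []))
                     (labels (2 ∷ 3 ∷ 6 ∷ 5 ∷ 4 ∷ 7 ∷ [])) 0 7
labelling₆₊ 1 =
  checkedLabelling 4 (labels (1 ∷ 4 ∷ 7 ∷ 1 ∷ 3 ∷ 8 ∷ 5 ∷ []))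
                     (labels (2 ∷ 3 ∷ 8 ∷ 5 ∷ 4 ∷ 7 ∷ 6 ∷ [])) 0 8
labelling₆₊ 2 =
  checkedLabelling 5 (labels (1 ∷ 6 ∷ 8 ∷ 2 ∷ 9 ∷ 1 ∷ 3 ∷ 5 ∷ [])) (2 +_) 0 9
labelling₆₊ 3 =
  checkedLabelling 6 (labels (1 ∷ 6 ∷ 8 ∷ 1 ∷ 3 ∷ 10 ∷ 1 ∷ 3 ∷ 5 ∷ [])) (2 +_) 0 10
labelling₆₊ 4 =
  checkedLabelling 7 (labels (1 ∷ 6 ∷ 8 ∷ 1 ∷ 3 ∷ 10 ∷ 1 ∷ 3 ∷ 5 ∷ 7 ∷ [])) (2 +_) 0 11
labelling₆₊ 5 =
  checkedLabelling 8 (labels (1 ∷ 6 ∷ 8 ∷ 1 ∷ 3 ∷ 10 ∷ 1 ∷ 3 ∷ 5 ∷ 7 ∷ 4 ∷ [])) (2 +_) 0 12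
labelling₆₊ (suc (suc (suc (suc (suc (suc m)))))) =
  subst (HasL21Within _) (+-comm 1 (12 + m)) (LargeCycle.labelling m)

proposition3p2 :
    IsLambda (Mycielski (Cycle 3)) 6 ×
    IsLambda (Mycielski (Cycle 4)) 8 ×
    IsLambda (Mycielski (Cycle 5)) 10 ×
    (∀ (n : ℕ) → 6 ≤ n → IsLambda (Mycielski (Cycle n)) (n + 1))
proposition3p2 =
  (labelling₃ , λ _ → diameter₂⇒2n≤ 3) ,
  (labelling₄ , λ _ → diameter₂⇒2n≤ 4) ,
  (labelling₅ , λ _ → diameter₂⇒2n≤ 5) ,
  λ { n (s≤s (s≤s (s≤s (s≤s (s≤s (s≤s {n = k} _)))))) →
        labelling₆₊ k ,
        λ j labelling → subst (_≤ j) (+-comm 1 n) (copies-apex-bound (s≤s z≤n) labelling) }
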